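{- Let $\mathbf{L}$ be a dually ms Stone semi-Heyting algebra and $x\in L$. Then $(x^*)'' = x^*$.
   Context: A semi-Heyting algebra is an algebra $\langle L,\vee,\wedge,\to,0,1\rangle$ such that $\langle L,\vee,\wedge,0,1\rangle$ is a bounded lattice and the identities $x\wedge(x\to y)\approx x\wedge y$, $x\wedge(y\to z)\approx x\wedge[(x\wedge y)\to(x\wedge z)]$, and $x\to x\approx 1$ hold; $x^* := x\to 0$ is the pseudocomplement. A dually quasi-De Morgan semi-Heyting algebra is an algebra $\langle L,\vee,\wedge,\to,{}',0,1\rangle$ whose reduct $\langle L,\vee,\wedge,\to,0,1\rangle$ is a semi-Heyting algebra and which satisfies $0'\approx 1$, $1'\approx 0$, $(x\wedge y)'\approx x'\vee y'$, $(x\vee y)''\approx x''\vee y''$, and $x''\le x$. A dually ms Stone semi-Heyting algebra is a dually quasi-De Morgan semi-Heyting algebra that additionally satisfies $(x\vee y)'\approx x'\wedge y'$ and the Stone identity $x^*\vee x^{**}\approx 1$. -}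

module Defs where

open import Level using (Level; suc)
open import Relation.Binary.PropositionalEquality using (_≡_)
open import Algebra.Core using (Op₁; Op₂)
open import Algebra.Lattice.Structures using (IsLattice)

record DmsStoneSH (c : Level) : Set (suc c) where
  infixr 5 _⇒_
  infixr 7 _∧_
  infixr 6 _∨_
  field
    Carrier : Set c
    _∨_ _∧_ _⇒_ : Op₂ Carrier
    _′ : Op₁ Carrier
    ⊥ ⊤ : Carrier
    isLattice : IsLattice _≡_ _∨_ _∧_
    ∧-zeroʳ : ∀ x → x ∧ ⊥ ≡ ⊥
    ∧-identityʳ : ∀ x → x ∧ ⊤ ≡ x
  _≤_ : Carrier → Carrier → Set c
  x ≤ y = x ∧ y ≡ x
  _* : Op₁ Carrier
  x * = x ⇒ ⊥
  field
    SH1 : ∀ x y → x ∧ (x ⇒ y) ≡ x ∧ y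
    SH2 : ∀ x y z → x ∧ (y ⇒ z) ≡ x ∧ ((x ∧ y) ⇒ (x ∧ z))
    SH3 : ∀ x → x ⇒ x ≡ ⊤
    ⊥′ : ⊥ ′ ≡ ⊤
    ⊤′ : ⊤ ′ ≡ ⊥
    ∧′ : ∀ x y → (x ∧ y) ′ ≡ (x ′) ∨ (y ′)
    ∨′′ : ∀ x y → ((x ∨ y) ′) ′ ≡ ((x ′) ′) ∨ ((y ′) ′)
    ′′≤ : ∀ x → ((x ′) ′) ≤ x
    ∨′ : ∀ x y → (x ∨ y) ′ ≡ (x ′) ∧ (y ′)
    stone : ∀ x → (x *) ∨ ((x *) *) ≡ ⊤

module Submission where

-- Put a = x*.  The Stone identity says exactly that a ∨ a* = ⊤,
-- i.e. a has a complement-like partner a*.  We show, more generally, that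
-- every a with a ∨ a* = ⊤ is fixed by the double dual ′′:
--   * a′′ ≤ a is an axiom, so only a ≤ a′′ remains;
--   * applying ′′ to a ∨ a* = ⊤ (using (x ∨ y)′′ = x′′ ∨ y′′) gives
--     a′′ ∨ (a*)′′ = ⊤, and (a*)′′ ≤ a* is disjoint from a;
--   * a semi-Heyting "complement bound": if p ∨ q = ⊤ and q ∧ a = ⊥ then
--     a ≤ p.  Its proof avoids distributivity: the element h = a ⇒ (a ∧ p)
--     lies above both p and q, hence h = ⊤, and a = a ∧ h = a ∧ p.
-- The file first collects the lattice facts used, then the semi-Heyting
-- facts, then the fixed-point lemma, and derives the theorem from the
-- Stone identity.

open import Level using (Level)
open import Relation.Binary.PropositionalEquality using (_≡_; sym; trans; cong; module ≡-Reasoning)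
open import Algebra.Lattice.Bundles using (Lattice)
open import Algebra.Lattice.Structures using (IsLattice)
import Algebra.Lattice.Properties.Lattice as LatticeProperties
open import Defs

module DmsStoneSHProperties {c : Level} (L : DmsStoneSH c) where
  open DmsStoneSH L
  open IsLattice isLattice using (∨-comm; ∨-assoc; ∧-comm; ∧-assoc; ∨-absorbs-∧)
  open ≡-Reasoning

  lattice : Lattice c c
  lattice = record { isLattice = isLattice }

  open LatticeProperties lattice using (∧-idem)

  ∧-zeroˡ : ∀ x → ⊥ ∧ x ≡ ⊥
  ∧-zeroˡ x = trans (∧-comm ⊥ x) (∧-zeroʳ x)

  ≤-antisym : ∀ {x y} → x ≤ y → y ≤ x → x ≡ y
  ≤-antisym {x} {y} x≤y y≤x = trans (sym x≤y) (trans (∧-comm x y) y≤x)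

  ∧-lowerˡ : ∀ x y → (x ∧ y) ≤ x
  ∧-lowerˡ x y = begin
    (x ∧ y) ∧ x ≡⟨ ∧-comm (x ∧ y) x ⟩
    x ∧ (x ∧ y) ≡⟨ sym (∧-assoc x x y) ⟩
    (x ∧ x) ∧ y ≡⟨ cong (_∧ y) (∧-idem x) ⟩
    x ∧ y       ∎

  ≤-disjoint : ∀ {q b a} → q ≤ b → b ∧ a ≡ ⊥ → q ∧ a ≡ ⊥
  ≤-disjoint {q} {b} {a} q≤b b∧a≡⊥ = begin
    q ∧ a       ≡⟨ cong (_∧ a) (sym q≤b) ⟩
    (q ∧ b) ∧ a ≡⟨ ∧-assoc q b a ⟩
    q ∧ (b ∧ a) ≡⟨ cong (q ∧_) b∧a≡⊥ ⟩
    q ∧ ⊥       ≡⟨ ∧-zeroʳ q ⟩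
    ⊥           ∎

  ≤⇒∨≡ : ∀ {p h} → p ≤ h → p ∨ h ≡ h
  ≤⇒∨≡ {p} {h} p≤h = begin
    p ∨ h       ≡⟨ cong (_∨ h) (sym p≤h) ⟩
    (p ∧ h) ∨ h ≡⟨ ∨-comm (p ∧ h) h ⟩
    h ∨ (p ∧ h) ≡⟨ cong (h ∨_) (∧-comm p h) ⟩
    h ∨ (h ∧ p) ≡⟨ ∨-absorbs-∧ h p ⟩
    h           ∎

  ⊤-maximum : ∀ h → ⊤ ∨ h ≡ ⊤
  ⊤-maximum h = begin
    ⊤ ∨ h       ≡⟨ cong (⊤ ∨_) (sym (trans (∧-comm ⊤ h) (∧-identityʳ h))) ⟩
    ⊤ ∨ (⊤ ∧ h) ≡⟨ ∨-absorbs-∧ ⊤ h ⟩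
    ⊤           ∎

  cover-bound : ∀ {p q h} → p ∨ q ≡ ⊤ → p ≤ h → q ≤ h → h ≡ ⊤
  cover-bound {p} {q} {h} p∨q≡⊤ p≤h q≤h = begin
    h           ≡⟨ sym (≤⇒∨≡ q≤h) ⟩
    q ∨ h       ≡⟨ cong (q ∨_) (sym (≤⇒∨≡ p≤h)) ⟩
    q ∨ (p ∨ h) ≡⟨ sym (∨-assoc q p h) ⟩
    (q ∨ p) ∨ h ≡⟨ cong (_∨ h) (trans (∨-comm q p) p∨q≡⊤) ⟩
    ⊤ ∨ h       ≡⟨ ⊤-maximum h ⟩
    ⊤           ∎

  ∧-* : ∀ x → x ∧ (x *) ≡ ⊥
  ∧-* x = trans (SH1 x ⊥) (∧-zeroʳ x)

  residuation : ∀ {x y z} → (x ∧ y) ≤ z → x ≤ (y ⇒ (y ∧ z))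
  residuation {x} {y} {z} x∧y≤z = begin
    x ∧ (y ⇒ (y ∧ z))             ≡⟨ SH2 x y (y ∧ z) ⟩
    x ∧ ((x ∧ y) ⇒ (x ∧ (y ∧ z))) ≡⟨ cong (λ w → x ∧ ((x ∧ y) ⇒ w)) (trans (sym (∧-assoc x y z)) x∧y≤z) ⟩
    x ∧ ((x ∧ y) ⇒ (x ∧ y))       ≡⟨ cong (x ∧_) (SH3 (x ∧ y)) ⟩
    x ∧ ⊤                         ≡⟨ ∧-identityʳ x ⟩
    x                             ∎

  -- Complement bound: if p ∨ q = ⊤ and q is disjoint from a, then a ≤ p.
  -- The witness h = a ⇒ (a ∧ p) is above p and q, hence equal to ⊤.
  complement-bound : ∀ {a p q} → p ∨ q ≡ ⊤ → q ∧ a ≡ ⊥ → a ≤ p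
  complement-bound {a} {p} {q} p∨q≡⊤ q∧a≡⊥ = begin
    a ∧ p       ≡⟨ cong (_∧ p) (sym (∧-idem a)) ⟩
    (a ∧ a) ∧ p ≡⟨ ∧-assoc a a p ⟩
    a ∧ (a ∧ p) ≡⟨ sym (SH1 a (a ∧ p)) ⟩
    a ∧ h       ≡⟨ cong (a ∧_) h≡⊤ ⟩
    a ∧ ⊤       ≡⟨ ∧-identityʳ a ⟩
    a           ∎
    where
    h = a ⇒ (a ∧ p)

    p≤h : p ≤ h
    p≤h = residuation (∧-lowerˡ p a)

    q≤h : q ≤ h
    q≤h = residuation (begin
      (q ∧ a) ∧ p ≡⟨ cong (_∧ p) q∧a≡⊥ ⟩
      ⊥ ∧ p       ≡⟨ ∧-zeroˡ p ⟩
      ⊥           ≡⟨ sym q∧a≡⊥ ⟩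
      q ∧ a       ∎)

    h≡⊤ : h ≡ ⊤
    h≡⊤ = cover-bound p∨q≡⊤ p≤h q≤h

  ′′-preserves-cover : ∀ {x y} → x ∨ y ≡ ⊤ → (x ′) ′ ∨ (y ′) ′ ≡ ⊤
  ′′-preserves-cover {x} {y} x∨y≡⊤ = begin
    (x ′) ′ ∨ (y ′) ′ ≡⟨ sym (∨′′ x y) ⟩
    ((x ∨ y) ′) ′     ≡⟨ cong (λ w → (w ′) ′) x∨y≡⊤ ⟩
    (⊤ ′) ′           ≡⟨ cong _′ ⊤′ ⟩
    ⊥ ′               ≡⟨ ⊥′ ⟩
    ⊤                 ∎

  complemented⇒′′-fixed : ∀ a → a ∨ (a *) ≡ ⊤ → (a ′) ′ ≡ a
  complemented⇒′′-fixed a a∨a*≡⊤ = ≤-antisym (′′≤ a) a≤a′′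
    where
    a*′′-disjoint : ((a *) ′) ′ ∧ a ≡ ⊥
    a*′′-disjoint = ≤-disjoint (′′≤ (a *)) (trans (∧-comm (a *) a) (∧-* a))

    a≤a′′ : a ≤ ((a ′) ′)
    a≤a′′ = complement-bound (′′-preserves-cover a∨a*≡⊤) a*′′-disjoint

lemma4p5 : ∀ {c : Level} (L : DmsStoneSH c) (x : DmsStoneSH.Carrier L) →
    let open DmsStoneSH L in ((x *) ′) ′ ≡ x *
lemma4p5 L x = complemented⇒′′-fixed (x *) (stone x)
  where
  open DmsStoneSH L
  open DmsStoneSHProperties L
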